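{- For any $\phi\in\mathsf{BSML}$, if $\phi$ has the empty state property, then $\phi$ is downward closed.
   Context: Formulas of $\mathsf{BSML}$ are generated by $\phi ::= p \mid \neg\phi \mid (\phi\wedge\phi) \mid (\phi\vee\phi) \mid \Diamond\phi \mid \mathrm{NE}$. A Kripke model is $M=(W,R,V)$ with $W\neq\emptyset$, $R\subseteq W\times W$, $V$ a valuation; a state is any $s\subseteq W$, $R[w]=\{v\mid wRv\}$. Support $M,s\vDash\phi$ and anti-support $M,s\mathrel{=\!\!\mid}\phi$: $s\vDash p$ iff $w\in V(p)$ for all $w\in s$; $s\mathrel{=\!\!\mid} p$ iff $w\notin V(p)$ for all $w\in s$; $s\vDash\mathrm{NE}$ iff $s\neq\emptyset$; $s\mathrel{=\!\!\mid}\mathrm{NE}$ iff $s=\emptyset$; $s\vDash\neg\phi$ iff $s\mathrel{=\!\!\mid}\phi$; $s\mathrel{=\!\!\mid}\neg\phi$ iff $s\vDash\phi$; $s\vDash\phi\wedge\psi$ iff $s\vDash\phi$ and $s\vDash\psi$; $s\mathrel{=\!\!\mid}\phi\wedge\psi$ iff $s=t\cup u$ with $t\mathrel{=\!\!\mid}\phi$, $u\mathrel{=\!\!\mid}\psi$; $s\vDash\phi\vee\psi$ iff $s=t\cup u$ with $t\vDash\phi$, $u\vDash\psi$; $s\mathrel{=\!\!\mid}\phi\vee\psi$ iff $s\mathrel{=\!\!\mid}\phi$ and $s\mathrel{=\!\!\mid}\psi$; $s\vDash\Diamond\phi$ iff for every $w\in s$ there is a nonempty $t\subseteq R[w]$ with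 $t\vDash\phi$; $s\mathrel{=\!\!\mid}\Diamond\phi$ iff $R[w]\mathrel{=\!\!\mid}\phi$ for all $w\in s$. $\phi$ has the empty state property if $M,\emptyset\vDash\phi$ for all $M$; $\phi$ is downward closed if $M,s\vDash\phi$ and $t\subseteq s$ imply $M,t\vDash\phi$. -}

module Defs where

open import Data.Nat using (ℕ)
open import Data.Product using (Σ; ∃; _×_; _,_)
open import Data.Sum using (_⊎_)
open import Data.Empty using (⊥)
open import Relation.Nullary using (¬_)
open import Function.Bundles using (_⇔_)
open import Level using (Lift; lift)

Lift′ : Set → Set₁
Lift′ A = Lift _ A

data Form : Set where
  var  : ℕ → Form
  ¬'_  : Form → Form
  _∧'_ : Form → Form → Form
  _∨'_ : Form → Form → Form
  ◇_   : Form → Form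
  NE   : Form

record Model : Set₁ where
  field
    W   : Set
    w₀  : W              -- witness that W ≠ ∅
    R   : W → W → Set
    V   : ℕ → W → Set

State : Set → Set₁
State W = W → Set

module _ (M : Model) where
  open Model M

  _⊆_ : State W → State W → Set
  s ⊆ t = ∀ w → s w → t w

  IsUnion : State W → State W → State W → Set
  IsUnion s t u = ∀ w → s w ⇔ (t w ⊎ u w)

  Empty : State W → Set
  Empty s = ∀ w → ¬ s w

  NonEmpty : State W → Set
  NonEmpty s = ∃ λ w → s w

  Succ : W → State W
  Succ w v = R w v

  mutual
    _⊨_ : State W → Form → Set₁
    s ⊨ var p = Lift′ (∀ w → s w → V p w)
    s ⊨ NE = Lift′ (NonEmpty s)
    s ⊨ (¬' φ) = s ⫤ φ
    s ⊨ (φ ∧' ψ) = (s ⊨ φ) × (s ⊨ ψ)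
    s ⊨ (φ ∨' ψ) = Σ (State W) λ t → Σ (State W) λ u →
                     Lift′ (IsUnion s t u) × (t ⊨ φ) × (u ⊨ ψ)
    s ⊨ (◇ φ) = ∀ w → s w → Σ (State W) λ t →
                     Lift′ (t ⊆ Succ w) × Lift′ (NonEmpty t) × (t ⊨ φ)

    _⫤_ : State W → Form → Set₁
    s ⫤ var p = Lift′ (∀ w → s w → ¬ V p w)
    s ⫤ NE = Lift′ (Empty s)
    s ⫤ (¬' φ) = s ⊨ φ
    s ⫤ (φ ∧' ψ) = Σ (State W) λ t → Σ (State W) λ u →
                     Lift′ (IsUnion s t u) × (t ⫤ φ) × (u ⫤ ψ)
    s ⫤ (φ ∨' ψ) = (s ⫤ φ) × (s ⫤ ψ)
    s ⫤ (◇ φ) = ∀ w → s w → Succ w ⫤ φ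


∅ : {W : Set} → State W
∅ _ = ⊥

EmptyStateProperty : Form → Set₁
EmptyStateProperty φ = ∀ (M : Model) → _⊨_ M ∅ φ

DownwardClosed : Form → Set₁
DownwardClosed φ = ∀ (M : Model) (s t : State (Model.W M)) →
  _⊨_ M s φ → _⊆_ M t s → _⊨_ M t φ

-- Support and anti-support of every BSML formula are union closed and convex
-- (s ⊆ t ⊆ u, s ⊨ φ and u ⊨ φ give t ⊨ φ); the only non-local clauses are the
-- split ones (∨ for support, ∧ for anti-support). Convexity with s = ∅ turns
-- the empty state property into downward closure.
module Submission where

open import Defs
open import Data.Product using (Σ; _×_; _,_)
open import Data.Sum as Sum using (_⊎_; inj₁; inj₂; [_,_])
open import Function.Bundles using (mk⇔; Equivalence)
open import Function.Base using (id)
open import Level using (Level; _⊔_; 0ℓ; lift) renaming (suc to lsuc)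
open import Relation.Unary using (_∪_; _∩_)

module _ (M : Model) where
  open Model M

  private
    variable
      ℓ : Level
      s t u v s₁ s₂ u₁ u₂ : State W

  UnionClosed : (State W → Set ℓ) → Set (lsuc 0ℓ ⊔ ℓ)
  UnionClosed P = ∀ {v s u} → IsUnion M v s u → P s → P u → P v

  Convex : (State W → Set ℓ) → Set (lsuc 0ℓ ⊔ ℓ)
  Convex P = ∀ {s t u} → _⊆_ M s t → _⊆_ M t u → P s → P u → P t

  -- Local and Split are the shapes the clauses of _⊨_ and _⫤_ have definitionally.
  Local : (W → Set ℓ) → State W → Set ℓ
  Local Q s = ∀ w → s w → Q w

  Split : (State W → Set₁) → (State W → Set₁) → State W → Set₁
  Split P Q s = Σ (State W) λ t → Σ (State W) λ u →
                  Lift′ (IsUnion M s t u) × P t × Q u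

  Supported AntiSupported : Form → State W → Set₁
  Supported φ s = _⊨_ M s φ
  AntiSupported φ s = _⫤_ M s φ

  ∪-isUnion : IsUnion M (s ∪ u) s u
  ∪-isUnion w = mk⇔ id id

  isUnion⇒ : IsUnion M v s u → ∀ w → v w → s w ⊎ u w
  isUnion⇒ v=s∪u w = Equivalence.to (v=s∪u w)

  isUnion⇐ : IsUnion M v s u → ∀ w → s w ⊎ u w → v w
  isUnion⇐ v=s∪u w = Equivalence.from (v=s∪u w)

  isUnion-interchange : IsUnion M v s u → IsUnion M s s₁ s₂ → IsUnion M u u₁ u₂ →
                        IsUnion M v (s₁ ∪ u₁) (s₂ ∪ u₂)
  isUnion-interchange {v} {s} {u} {s₁} {s₂} {u₁} {u₂} v=s∪u s=s₁∪s₂ u=u₁∪u₂ w = mk⇔ to from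
    where
      to : v w → (s₁ ∪ u₁) w ⊎ (s₂ ∪ u₂) w
      to vw with isUnion⇒ v=s∪u w vw
      ... | inj₁ sw = Sum.map inj₁ inj₁ (isUnion⇒ s=s₁∪s₂ w sw)
      ... | inj₂ uw = Sum.map inj₂ inj₂ (isUnion⇒ u=u₁∪u₂ w uw)
      from : (s₁ ∪ u₁) w ⊎ (s₂ ∪ u₂) w → v w
      from (inj₁ (inj₁ x)) = isUnion⇐ v=s∪u w (inj₁ (isUnion⇐ s=s₁∪s₂ w (inj₁ x)))
      from (inj₁ (inj₂ x)) = isUnion⇐ v=s∪u w (inj₂ (isUnion⇐ u=u₁∪u₂ w (inj₁ x)))
      from (inj₂ (inj₁ x)) = isUnion⇐ v=s∪u w (inj₁ (isUnion⇐ s=s₁∪s₂ w (inj₂ x)))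
      from (inj₂ (inj₂ x)) = isUnion⇐ v=s∪u w (inj₂ (isUnion⇐ u=u₁∪u₂ w (inj₂ x)))

  -- The pieces of s are enlarged by the parts of the pieces of u that lie in t.
  isUnion-between : _⊆_ M s t → _⊆_ M t u → IsUnion M s s₁ s₂ → IsUnion M u u₁ u₂ →
                    IsUnion M t (s₁ ∪ (u₁ ∩ t)) (s₂ ∪ (u₂ ∩ t))
  isUnion-between {s} {t} {u} {s₁} {s₂} {u₁} {u₂} s⊆t t⊆u s=s₁∪s₂ u=u₁∪u₂ w = mk⇔ to from
    where
      to : t w → (s₁ ∪ (u₁ ∩ t)) w ⊎ (s₂ ∪ (u₂ ∩ t)) w
      to tw = Sum.map (λ x → inj₂ (x , tw)) (λ x → inj₂ (x , tw)) (isUnion⇒ u=u₁∪u₂ w (t⊆u w tw))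
      from : (s₁ ∪ (u₁ ∩ t)) w ⊎ (s₂ ∪ (u₂ ∩ t)) w → t w
      from (inj₁ (inj₁ x)) = s⊆t w (isUnion⇐ s=s₁∪s₂ w (inj₁ x))
      from (inj₂ (inj₁ x)) = s⊆t w (isUnion⇐ s=s₁∪s₂ w (inj₂ x))
      from (inj₁ (inj₂ (_ , tw))) = tw
      from (inj₂ (inj₂ (_ , tw))) = tw

  local-unionClosed : {Q : W → Set ℓ} → UnionClosed (Local Q)
  local-unionClosed v=s∪u Qs Qu w vw = [ Qs w , Qu w ] (isUnion⇒ v=s∪u w vw)

  local-convex : {Q : W → Set ℓ} → Convex (Local Q)
  local-convex _ t⊆u _ Qu w tw = Qu w (t⊆u w tw)

  lift-unionClosed : {P : State W → Set} → UnionClosed P → UnionClosed (λ s → Lift′ (P s))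
  lift-unionClosed P-union v=s∪u (lift Ps) (lift Pu) = lift (P-union v=s∪u Ps Pu)

  lift-convex : {P : State W → Set} → Convex P → Convex (λ s → Lift′ (P s))
  lift-convex P-convex s⊆t t⊆u (lift Ps) (lift Pu) = lift (P-convex s⊆t t⊆u Ps Pu)

  nonEmpty-unionClosed : UnionClosed (NonEmpty M)
  nonEmpty-unionClosed v=s∪u (w , sw) _ = w , isUnion⇐ v=s∪u w (inj₁ sw)

  nonEmpty-convex : Convex (NonEmpty M)
  nonEmpty-convex s⊆t _ (w , sw) _ = w , s⊆t w sw

  ∩-unionClosed : {P Q : State W → Set₁} → UnionClosed P → UnionClosed Q → UnionClosed (P ∩ Q)
  ∩-unionClosed P-union Q-union v=s∪u (Ps , Qs) (Pu , Qu) = P-union v=s∪u Ps Pu , Q-union v=s∪u Qs Qu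

  ∩-convex : {P Q : State W → Set₁} → Convex P → Convex Q → Convex (P ∩ Q)
  ∩-convex P-convex Q-convex s⊆t t⊆u (Ps , Qs) (Pu , Qu) =
    P-convex s⊆t t⊆u Ps Pu , Q-convex s⊆t t⊆u Qs Qu

  split-unionClosed : {P Q : State W → Set₁} → UnionClosed P → UnionClosed Q →
                      UnionClosed (Split P Q)
  split-unionClosed P-union Q-union v=s∪u
    (s₁ , s₂ , lift s=s₁∪s₂ , Ps₁ , Qs₂) (u₁ , u₂ , lift u=u₁∪u₂ , Pu₁ , Qu₂) =
    s₁ ∪ u₁ , s₂ ∪ u₂ , lift (isUnion-interchange v=s∪u s=s₁∪s₂ u=u₁∪u₂) ,
    P-union ∪-isUnion Ps₁ Pu₁ , Q-union ∪-isUnion Qs₂ Qu₂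

  split-convex : {P Q : State W → Set₁} → UnionClosed P → Convex P → UnionClosed Q → Convex Q →
                 Convex (Split P Q)
  split-convex P-union P-convex Q-union Q-convex {t = t} s⊆t t⊆u
    (s₁ , s₂ , lift s=s₁∪s₂ , Ps₁ , Qs₂) (u₁ , u₂ , lift u=u₁∪u₂ , Pu₁ , Qu₂) =
    s₁ ∪ (u₁ ∩ t) , s₂ ∪ (u₂ ∩ t) , lift (isUnion-between s⊆t t⊆u s=s₁∪s₂ u=u₁∪u₂) ,
    P-convex inj₁-⊆ (∪∩-⊆-∪ u₁) Ps₁ (P-union ∪-isUnion Ps₁ Pu₁) ,
    Q-convex inj₁-⊆ (∪∩-⊆-∪ u₂) Qs₂ (Q-union ∪-isUnion Qs₂ Qu₂)
    where
      inj₁-⊆ : ∀ {a b : State W} → _⊆_ M a (a ∪ b)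
      inj₁-⊆ _ = inj₁
      ∪∩-⊆-∪ : ∀ {a : State W} b → _⊆_ M (a ∪ (b ∩ t)) (a ∪ b)
      ∪∩-⊆-∪ _ w = Sum.map id (λ (x , _) → x)

  mutual
    supported-unionClosed : ∀ φ → UnionClosed (Supported φ)
    supported-unionClosed (var p) = lift-unionClosed local-unionClosed
    supported-unionClosed NE = lift-unionClosed nonEmpty-unionClosed
    supported-unionClosed (¬' φ) = antiSupported-unionClosed φ
    supported-unionClosed (φ ∧' ψ) = ∩-unionClosed (supported-unionClosed φ) (supported-unionClosed ψ)
    supported-unionClosed (φ ∨' ψ) = split-unionClosed (supported-unionClosed φ) (supported-unionClosed ψ)
    supported-unionClosed (◇ φ) = local-unionClosed

    antiSupported-unionClosed : ∀ φ → UnionClosed (AntiSupported φ)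
    antiSupported-unionClosed (var p) = lift-unionClosed local-unionClosed
    antiSupported-unionClosed NE = lift-unionClosed local-unionClosed
    antiSupported-unionClosed (¬' φ) = supported-unionClosed φ
    antiSupported-unionClosed (φ ∧' ψ) =
      split-unionClosed (antiSupported-unionClosed φ) (antiSupported-unionClosed ψ)
    antiSupported-unionClosed (φ ∨' ψ) =
      ∩-unionClosed (antiSupported-unionClosed φ) (antiSupported-unionClosed ψ)
    antiSupported-unionClosed (◇ φ) = local-unionClosed

  mutual
    supported-convex : ∀ φ → Convex (Supported φ)
    supported-convex (var p) = lift-convex local-convex
    supported-convex NE = lift-convex nonEmpty-convex
    supported-convex (¬' φ) = antiSupported-convex φ
    supported-convex (φ ∧' ψ) = ∩-convex (supported-convex φ) (supported-convex ψ)
    supported-convex (φ ∨' ψ) =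
      split-convex (supported-unionClosed φ) (supported-convex φ)
                   (supported-unionClosed ψ) (supported-convex ψ)
    supported-convex (◇ φ) = local-convex

    antiSupported-convex : ∀ φ → Convex (AntiSupported φ)
    antiSupported-convex (var p) = lift-convex local-convex
    antiSupported-convex NE = lift-convex local-convex
    antiSupported-convex (¬' φ) = supported-convex φ
    antiSupported-convex (φ ∧' ψ) =
      split-convex (antiSupported-unionClosed φ) (antiSupported-convex φ)
                   (antiSupported-unionClosed ψ) (antiSupported-convex ψ)
    antiSupported-convex (φ ∨' ψ) = ∩-convex (antiSupported-convex φ) (antiSupported-convex ψ)
    antiSupported-convex (◇ φ) = local-convex

lemma3p18 : (φ : Form) → EmptyStateProperty φ → DownwardClosed φ
lemma3p18 φ esp M s t s⊨φ t⊆s = supported-convex M φ (λ _ ()) t⊆s (esp M) s⊨φ
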